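{- Let $k\in\mathbb{N}$. Every minor-obstruction of $\mathcal{F}^{(k)}$ belongs to $\mathcal{F}^{(k+2)}\setminus\mathcal{F}^{(k)}$.
   Context: For $X\subseteq V(G)$, $G/\!\!/X$ is obtained from $G$ by deleting $X$ and adding a new vertex adjacent to every vertex of $N_G(X)=\bigcup_{v\in X}N_G(v)\setminus X$. For a partition $\mathcal{X}=\{X_1,\dots,X_p\}$ of some subset of $V(G)$ into non-empty parts, $G/\!\!/\mathcal{X}:=G/\!\!/X_1\cdots/\!\!/X_p$, with order $|X_1\cup\dots\cup X_p|$. $\mathsf{idf}(G)$ is the minimum order of such $\mathcal{X}$ with $G/\!\!/\mathcal{X}$ acyclic, and $\mathcal{F}^{(k)}=\{G\mid\mathsf{idf}(G)\le k\}$. A minor-obstruction of a class $\mathcal{C}$ is a graph not in $\mathcal{C}$ all of whose proper minors are in $\mathcal{C}$. -}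

module Defs where

open import Data.Nat using (ℕ; zero; suc; _+_; _≤_)
open import Data.Bool using (Bool; true; false; if_then_else_)
open import Data.Fin using (Fin; zero; suc; inject₁; fromℕ)
open import Data.Maybe using (Maybe; just; nothing; is-just)
open import Data.List using (List; map; allFin)
open import Data.Nat.ListAction using (sum)
open import Data.Product using (Σ; ∃; _×_; _,_)
open import Data.Sum using (_⊎_; inj₁; inj₂)
open import Data.Empty using (⊥)
open import Relation.Nullary using (¬_)
open import Relation.Binary.PropositionalEquality using (_≡_; _≢_)
open import Relation.Binary.Construct.Closure.ReflexiveTransitive using (Star)
open import Function.Bundles using (_⤖_; Bijection)
open import Function.Definitions using (Injective)

record Graph : Set where
  field
    n     : ℕ
    adj   : Fin n → Fin n → Bool
    sym   : ∀ u v → adj u v ≡ adj v u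
    irr   : ∀ v → adj v v ≡ false
open Graph public

Adj : (G : Graph) → Fin (n G) → Fin (n G) → Set
Adj G u v = adj G u v ≡ true

record Cycle {V : Set} (R : V → V → Set) : Set where
  field
    m      : ℕ
    c      : Fin (suc (suc (suc m))) → V
    inj    : Injective _≡_ _≡_ c
    step   : ∀ (i : Fin (suc (suc m))) → R (c (inject₁ i)) (c (suc i))
    close  : R (c (fromℕ (suc (suc m)))) (c zero)

Acyclic : {V : Set} → (V → V → Set) → Set
Acyclic R = ¬ Cycle R

-- A partition 𝒳 = {X_1,…,X_p} of a subset of V(G) into non-empty parts,
-- encoded by a labelling f : V(G) → Maybe (Fin p)
-- (f v = just i  iff  v ∈ X_i;  f v = nothing iff v is in no part).

record Partition (G : Graph) : Set where
  field
    p        : ℕ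
    lab      : Fin (n G) → Maybe (Fin p)
    nonempty : ∀ (i : Fin p) → ∃ λ v → lab v ≡ just i
open Partition public

order : {G : Graph} → Partition G → ℕ
order {G} P = sum (map (λ v → if is-just (lab P v) then 1 else 0) (allFin (n G)))

-- The graph G//𝒳 = G//X_1 ⋯ //X_p.  Its vertices are the vertices of G
-- in no part, plus one new vertex x_i per part X_i.
QV : (G : Graph) → Partition G → Set
QV G P = (Σ (Fin (n G)) λ v → lab P v ≡ nothing) ⊎ Fin (p P)

QAdj : (G : Graph) (P : Partition G) → QV G P → QV G P → Set
QAdj G P (inj₁ (u , _)) (inj₁ (v , _)) = Adj G u v
QAdj G P (inj₁ (u , _)) (inj₂ j) = ∃ λ w → lab P w ≡ just j × Adj G u w
QAdj G P (inj₂ i) (inj₁ (v , _)) = ∃ λ w → lab P w ≡ just i × Adj G w v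
QAdj G P (inj₂ i) (inj₂ j) =
  i ≢ j × (∃ λ u → ∃ λ w → lab P u ≡ just i × lab P w ≡ just j × Adj G u w)

-- G ∈ 𝓕^(k)  iff  idf(G) ≤ k
InF : ℕ → Graph → Set
InF k G = ∃ λ (P : Partition G) → order P ≤ k × Acyclic (QAdj G P)

record Minor (H G : Graph) : Set where
  field
    br        : Fin (n G) → Maybe (Fin (n H))
    nonempty  : ∀ (i : Fin (n H)) → ∃ λ v → br v ≡ just i
    connected : ∀ (i : Fin (n H)) (u v : Fin (n G)) → br u ≡ just i → br v ≡ just i →
                Star (λ a b → Adj G a b × br a ≡ just i × br b ≡ just i) u v
    edges     : ∀ (i j : Fin (n H)) → Adj H i j →
                ∃ λ u → ∃ λ v → br u ≡ just i × br v ≡ just j × Adj G u v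

record Iso (H G : Graph) : Set where
  field
    σ    : Fin (n H) ⤖ Fin (n G)
    pres : ∀ u v → adj G (Bijection.to σ u) (Bijection.to σ v) ≡ adj H u v

ProperMinor : Graph → Graph → Set
ProperMinor H G = Minor H G × ¬ Iso H G

Obstruction : (Graph → Set) → Graph → Set
Obstruction 𝒞 G = ¬ 𝒞 G × (∀ H → ProperMinor H G → 𝒞 H)

{-# OPTIONS --safe #-}
-- An obstruction G has an edge uv, since an edgeless graph is acyclic with no
-- part at all.  The contraction H = G/uv is a proper minor, so H//𝒳 is acyclic
-- for some 𝒳 of order at most k.  Making the contracted vertex w a singleton
-- part if it is free costs at most 1 and only renames a vertex of H//𝒳.  Pulling 𝒳 back
-- to G costs at most 1 more (u and v both land in the part of w), and G//𝒳 then
-- embeds into H//𝒳, because the only vertices identified by the contraction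
-- lie in a common part.
module Submission where

open import Defs hiding (sym)

open import Axiom.UniquenessOfIdentityProofs using (module Decidable⇒UIP)
open import Data.Bool using (true; if_then_else_)
import Data.Bool as Bool
open import Data.Bool.Properties using (T-≡)
open import Data.Fin using (Fin; zero; suc; punchIn; punchOut; _≟_)
open import Data.Fin.Properties
  using (any?; punchInᵢ≢i; punchOut-cong; punchOut-injective; punchOut-punchIn; suc-injective;
         <⇒notInjective)
open import Data.List using (tabulate)
open import Data.List.Properties using (map-tabulate)
open import Data.Maybe using (Maybe; just; nothing; is-just)
import Data.Maybe as Maybe
open import Data.Maybe.Properties using (just-injective; map-injective)
import Data.Maybe.Properties as Maybe
open import Data.Nat using (ℕ; zero; suc; _+_; _≤_; _<_; z≤n; s≤s)
import Data.Nat.ListAction as ListAction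
open import Data.Nat.Properties
  using (+-0-commutativeMonoid; +-commutativeSemigroup; +-comm; +-monoˡ-≤; ≤-refl; ≤-reflexive;
         ≤-trans; n≤1+n; n<1+n; module ≤-Reasoning)
open import Algebra.Properties.CommutativeMonoid.Sum +-0-commutativeMonoid
  using (sum-remove; sum-cong-≗; sum-replicate-zero) renaming (sum to ∑)
open import Algebra.Properties.CommutativeSemigroup +-commutativeSemigroup using (x∙yz≈y∙xz)
open import Data.Product using (_×_; ∃; ∃₂; _,_; proj₁; map₂)
open import Data.Sum using (_⊎_; inj₁; inj₂)
import Data.Sum as Sum
open import Data.Sum.Properties using (inj₁-injective; inj₂-injective)
open import Data.Vec.Functional using (removeAt)
open import Function using (_∘_; id; mk⇔; Injective; Equivalence; Injection)
open import Function.Properties.Bijection using (⤖⇒↔)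
open import Function.Properties.Inverse using (↔-sym; ↔⇒↣)
open import Relation.Binary.Construct.Closure.ReflexiveTransitive using (Star; ε; _◅_)
import Relation.Binary.Construct.Closure.ReflexiveTransitive as Star
open import Relation.Binary.Core using (_=[_]⇒_)
open import Relation.Binary.Definitions using (Decidable)
open import Relation.Binary.PropositionalEquality
  using (_≡_; _≢_; refl; sym; trans; cong; cong₂; subst; module ≡-Reasoning)
open import Relation.Nullary using (¬_; Dec; yes; no; does; ¬?; _×-dec_; contradiction)
open import Relation.Nullary.Decidable
  using (does-⇔; dec-true; dec-false; isYes≗does; toSum; toWitness)

Cycle-map : {A B : Set} {R : A → A → Set} {S : B → B → Set} (f : A → B) →
            Injective _≡_ _≡_ f → R =[ f ]⇒ S → Cycle R → Cycle S
Cycle-map f f-injective f-hom C = record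
  { m = m ; c = f ∘ c ; inj = inj ∘ f-injective ; step = f-hom ∘ step ; close = f-hom close }
  where open Cycle C

sum-tabulate : ∀ {n} (f : Fin n → ℕ) → ListAction.sum (tabulate f) ≡ ∑ f
sum-tabulate {zero}  f = refl
sum-tabulate {suc n} f = cong (f zero +_) (sum-tabulate (f ∘ suc))

∑-agree-off : ∀ {n} (z : Fin n) {f g : Fin n → ℕ} → (∀ a → a ≢ z → f a ≡ g a) →
              f z + ∑ g ≡ g z + ∑ f
∑-agree-off {suc n} z {f} {g} f≡g = begin
  f z + ∑ g                       ≡⟨ cong (f z +_) (sum-remove {i = z} g) ⟩
  f z + (g z + ∑ (removeAt g z))  ≡⟨ x∙yz≈y∙xz (f z) (g z) _ ⟩
  g z + (f z + ∑ (removeAt g z))  ≡⟨ cong (λ s → g z + (f z + s)) (sum-cong-≗ f≡g-off-z) ⟨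
  g z + (f z + ∑ (removeAt f z))  ≡⟨ cong (g z +_) (sum-remove {i = z} f) ⟨
  g z + ∑ f                       ∎
  where
  open ≡-Reasoning
  f≡g-off-z : ∀ a → f (punchIn z a) ≡ g (punchIn z a)
  f≡g-off-z a = f≡g (punchIn z a) (punchInᵢ≢i z a)

weight : {A : Set} → Maybe A → ℕ
weight x = if is-just x then 1 else 0

weight≤1 : {A : Set} (x : Maybe A) → weight x ≤ 1
weight≤1 (just _) = ≤-refl
weight≤1 nothing  = z≤n

weight-map : {A B : Set} (f : A → B) (x : Maybe A) → weight (Maybe.map f x) ≡ weight x
weight-map f (just _) = refl
weight-map f nothing  = refl

order-∑ : {G : Graph} (P : Partition G) → order P ≡ ∑ (weight ∘ lab P)
order-∑ P =
  trans (cong ListAction.sum (map-tabulate id (weight ∘ lab P))) (sum-tabulate (weight ∘ lab P))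

Adj-irrefl : (G : Graph) {v : Fin (n G)} → ¬ Adj G v v
Adj-irrefl G {v} vv = contradiction (trans (sym vv) (irr G v)) λ ()

Adj-sym : (G : Graph) {u v : Fin (n G)} → Adj G u v → Adj G v u
Adj-sym G {u} {v} uv = trans (Graph.sym G v u) uv

edge? : (G : Graph) → Dec (∃₂ λ u v → Adj G u v)
edge? G = any? λ u → any? λ v → adj G u v Bool.≟ true

<⇒¬Iso : {H G : Graph} → n H < n G → ¬ Iso H G
<⇒¬Iso H<G iso = <⇒notInjective H<G (Injection.injective (↔⇒↣ (↔-sym (⤖⇒↔ (Iso.σ iso)))))

_∈[_]_ : {G : Graph} → Fin (n G) → (P : Partition G) → QV G P → Set
a ∈[ P ] inj₁ (b , _) = a ≡ b
a ∈[ P ] inj₂ i       = lab P a ≡ just i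

module _ {G : Graph} {P : Partition G} where

  representative : (x : QV G P) → ∃ (_∈[ P ] x)
  representative (inj₁ (b , _)) = b , refl
  representative (inj₂ i)       = nonempty P i

  ∈-unique : ∀ {a} {x y : QV G P} → a ∈[ P ] x → a ∈[ P ] y → x ≡ y
  ∈-unique {x = inj₁ (_ , free)} {inj₁ (_ , free′)} refl refl =
    cong (λ e → inj₁ (_ , e)) (Decidable⇒UIP.≡-irrelevant (Maybe.≡-dec _≟_) free free′)
  ∈-unique {x = inj₁ (_ , free)} {inj₂ _} refl a∈y = contradiction (trans (sym a∈y) free) λ ()
  ∈-unique {x = inj₂ _} {inj₁ (_ , free)} a∈x refl = contradiction (trans (sym a∈x) free) λ ()
  ∈-unique {x = inj₂ _} {inj₂ _} a∈x a∈y = cong inj₂ (just-injective (trans (sym a∈x) a∈y))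

  QAdj⇒edge : ∀ {x y : QV G P} → QAdj G P x y →
              x ≢ y × ∃₂ λ a b → a ∈[ P ] x × b ∈[ P ] y × Adj G a b
  QAdj⇒edge {inj₁ (u , _)} {inj₁ (v , _)} uv =
    (λ x≡y → Adj-irrefl G (subst (Adj G u) (sym (cong proj₁ (inj₁-injective x≡y))) uv)) ,
    u , v , refl , refl , uv
  QAdj⇒edge {inj₁ (u , _)} {inj₂ _} (w , w∈y , uw) = (λ ()) , u , w , refl , w∈y , uw
  QAdj⇒edge {inj₂ _} {inj₁ (v , _)} (w , w∈x , wv) = (λ ()) , w , v , w∈x , refl , wv
  QAdj⇒edge {inj₂ _} {inj₂ _} (i≢j , a , b , a∈x , b∈y , ab) =
    i≢j ∘ inj₂-injective , a , b , a∈x , b∈y , ab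

  edge⇒QAdj : ∀ {x y : QV G P} {a b} →
              x ≢ y → a ∈[ P ] x → b ∈[ P ] y → Adj G a b → QAdj G P x y
  edge⇒QAdj {inj₁ _} {inj₁ _} _ refl refl ab = ab
  edge⇒QAdj {inj₁ _} {inj₂ _} {b = b} _ refl b∈y ab = b , b∈y , ab
  edge⇒QAdj {inj₂ _} {inj₁ _} {a} _ a∈x refl ab = a , a∈x , ab
  edge⇒QAdj {inj₂ _} {inj₂ _} {a} {b} x≢y a∈x b∈y ab = x≢y ∘ cong inj₂ , a , b , a∈x , b∈y , ab

module Embedding {G H : Graph} (P : Partition G) (Q : Partition H)
  (π : Fin (n G) → Fin (n H)) (φ : QV G P → QV H Q)
  (π-edge : ∀ {a b} → Adj G a b → π a ≡ π b ⊎ Adj H (π a) (π b))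
  (φ-preserves : ∀ {a x} → a ∈[ P ] x → π a ∈[ Q ] φ x)
  (φ-reflects : ∀ {a x} → π a ∈[ Q ] φ x → a ∈[ P ] x)
  where

  φ-injective : Injective _≡_ _≡_ φ
  φ-injective {x} {y} φx≡φy =
    let a , a∈x = representative x
    in ∈-unique a∈x (φ-reflects (subst (π a ∈[ Q ]_) φx≡φy (φ-preserves a∈x)))

  φ-homomorphism : QAdj G P =[ φ ]⇒ QAdj H Q
  φ-homomorphism xy with QAdj⇒edge xy
  ... | x≢y , a , b , a∈x , b∈y , ab with π-edge ab
  ...   | inj₁ πa≡πb =
    contradiction (∈-unique (φ-preserves a∈x) (subst (_∈[ Q ] _) (sym πa≡πb) (φ-preserves b∈y)))
                  (x≢y ∘ φ-injective)
  ...   | inj₂ πaπb = edge⇒QAdj (x≢y ∘ φ-injective) (φ-preserves a∈x) (φ-preserves b∈y) πaπb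

  acyclic : Acyclic (QAdj H Q) → Acyclic (QAdj G P)
  acyclic H-acyclic = H-acyclic ∘ Cycle-map φ φ-injective φ-homomorphism

emptyPartition : (G : Graph) → Partition G
emptyPartition G = record { p = 0 ; lab = λ _ → nothing ; nonempty = λ () }

order-emptyPartition : (G : Graph) → order (emptyPartition G) ≡ 0
order-emptyPartition G = trans (order-∑ (emptyPartition G)) (sum-replicate-zero (n G))

edgeless⇒InF : ∀ k {G : Graph} → ¬ (∃₂ λ u v → Adj G u v) → InF k G
edgeless⇒InF k {G} edgeless =
  emptyPartition G ,
  subst (_≤ k) (sym (order-emptyPartition G)) z≤n ,
  λ C → let _ , a , b , _ , _ , ab = QAdj⇒edge (Cycle.close C) in edgeless (a , b , ab)

module SingletonPart {G : Graph} (P : Partition G) (z : Fin (n G)) (z-free : lab P z ≡ nothing) where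

  label : Fin (n G) → Maybe (Fin (suc (p P)))
  label a with a ≟ z
  ... | yes _ = just zero
  ... | no _  = Maybe.map suc (lab P a)

  label-z : label z ≡ just zero
  label-z with z ≟ z
  ... | yes _   = refl
  ... | no z≢z = contradiction refl z≢z

  label-just⁺ : ∀ {a i} → lab P a ≡ just i → label a ≡ just (suc i)
  label-just⁺ {a} a∈i with a ≟ z
  ... | yes refl = contradiction (trans (sym a∈i) z-free) λ ()
  ... | no _     = cong (Maybe.map suc) a∈i

  label-zero⁻ : ∀ {a} → label a ≡ just zero → a ≡ z
  label-zero⁻ {a} e with a ≟ z
  ... | yes a≡z = a≡z
  ... | no _ with lab P a
  label-zero⁻ () | no _ | just _
  label-zero⁻ () | no _ | nothing

  label-suc⁻ : ∀ {a i} → label a ≡ just (suc i) → lab P a ≡ just i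
  label-suc⁻ {a} e with a ≟ z
  label-suc⁻ () | yes _
  ... | no _ = map-injective suc-injective e

  label-nothing⁻ : ∀ {a} → label a ≡ nothing → lab P a ≡ nothing
  label-nothing⁻ {a} e with a ≟ z
  label-nothing⁻ () | yes _
  ... | no _ = map-injective suc-injective e

  weight-label : ∀ a → a ≢ z → weight (label a) ≡ weight (lab P a)
  weight-label a a≢z with a ≟ z
  ... | yes a≡z = contradiction a≡z a≢z
  ... | no _    = weight-map suc (lab P a)

  partition : Partition G
  partition = record { p = suc (p P) ; lab = label ; nonempty = nonempty′ }
    where
    nonempty′ : ∀ i → ∃ λ a → label a ≡ just i
    nonempty′ zero    = z , label-z
    nonempty′ (suc i) = let a , a∈i = nonempty P i in a , label-just⁺ a∈i

  order-partition : order partition ≡ suc (order P)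
  order-partition = begin
    order partition                        ≡⟨ order-∑ partition ⟩
    ∑ (weight ∘ label)                     ≡⟨ cong (_+ ∑ (weight ∘ label)) (cong weight z-free) ⟨
    weight (lab P z) + ∑ (weight ∘ label)  ≡⟨ ∑-agree-off z weight-label ⟨
    weight (label z) + ∑ (weight ∘ lab P)  ≡⟨ cong₂ _+_ (cong weight label-z) (sym (order-∑ P)) ⟩
    suc (order P)                          ∎
    where open ≡-Reasoning

  ψ : QV G partition → QV G P
  ψ (inj₁ (a , free)) = inj₁ (a , label-nothing⁻ free)
  ψ (inj₂ zero)       = inj₁ (z , z-free)
  ψ (inj₂ (suc i))    = inj₂ i

  ψ-preserves : ∀ {a x} → a ∈[ partition ] x → a ∈[ P ] ψ x
  ψ-preserves {x = inj₁ _}       refl = refl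
  ψ-preserves {x = inj₂ zero}    a∈x  = label-zero⁻ a∈x
  ψ-preserves {x = inj₂ (suc _)} a∈x  = label-suc⁻ a∈x

  ψ-reflects : ∀ {a x} → a ∈[ P ] ψ x → a ∈[ partition ] x
  ψ-reflects {x = inj₁ _}       refl = refl
  ψ-reflects {x = inj₂ zero}    refl = label-z
  ψ-reflects {x = inj₂ (suc _)} a∈x  = label-just⁺ a∈x

  acyclic : Acyclic (QAdj G P) → Acyclic (QAdj G partition)
  acyclic = Embedding.acyclic partition P id ψ inj₂ ψ-preserves ψ-reflects

cover : {G : Graph} (P : Partition G) (z : Fin (n G)) →
        ∃ λ Q → (∃ λ i → lab Q z ≡ just i) × order Q ≤ suc (order P) ×
                (Acyclic (QAdj G P) → Acyclic (QAdj G Q))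
cover P z with lab P z in z∈P
... | just i  = P , (i , z∈P) , n≤1+n _ , id
... | nothing = partition , (zero , label-z) , ≤-reflexive order-partition , acyclic
  where open SingletonPart P z z∈P

comap : {G H : Graph} (π : Fin (n G) → Fin (n H)) → (∀ a → ∃ λ x → π x ≡ a) →
        Partition H → Partition G
comap π π-surjective Q = record
  { p = p Q
  ; lab = lab Q ∘ π
  ; nonempty = λ i → let a , a∈i = nonempty Q i
                         x , πx≡a = π-surjective a
                     in x , trans (cong (lab Q) πx≡a) a∈i
  }

module Quotient (G : Graph) {m : ℕ} (π : Fin (n G) → Fin m) where

  Linked : Fin m → Fin m → Set
  Linked a b = a ≢ b × ∃₂ λ x y → π x ≡ a × π y ≡ b × Adj G x y

  linked? : Decidable Linked
  linked? a b =
    ¬? (a ≟ b) ×-dec any? λ x → any? λ y → π x ≟ a ×-dec π y ≟ b ×-dec adj G x y Bool.≟ true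

  Linked-sym : ∀ {a b} → Linked a b → Linked b a
  Linked-sym (a≢b , x , y , πx , πy , xy) = a≢b ∘ sym , y , x , πy , πx , Adj-sym G xy

  graph : Graph
  graph = record
    { n = m
    ; adj = λ a b → does (linked? a b)
    ; sym = λ a b → does-⇔ (mk⇔ Linked-sym Linked-sym) (linked? a b) (linked? b a)
    ; irr = λ a → dec-false (linked? a a) λ (a≢a , _) → a≢a refl
    }

  Adj⇒Linked : ∀ {a b} → Adj graph a b → Linked a b
  Adj⇒Linked {a} {b} ab =
    toWitness (Equivalence.from T-≡ (trans (isYes≗does (linked? a b)) ab))

  Linked⇒Adj : ∀ {a b} → Linked a b → Adj graph a b
  Linked⇒Adj {a} {b} = dec-true (linked? a b)

  π-edge : ∀ {x y} → Adj G x y → π x ≡ π y ⊎ Adj graph (π x) (π y)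
  π-edge {x} {y} xy =
    Sum.map₂ (λ πx≢πy → Linked⇒Adj (πx≢πy , x , y , refl , refl , xy)) (toSum (π x ≟ π y))

  InFibre : Fin m → Fin (n G) → Fin (n G) → Set
  InFibre a x y = Adj G x y × π x ≡ a × π y ≡ a

  minor : (∀ a → ∃ λ x → π x ≡ a) →
          (∀ a x y → π x ≡ a → π y ≡ a → Star (InFibre a) x y) → Minor graph G
  minor π-surjective fibre-connected = record
    { br = just ∘ π
    ; nonempty = λ a → map₂ (cong just) (π-surjective a)
    ; connected = λ a x y πx πy →
        Star.map (map₂ λ (πx , πy) → cong just πx , cong just πy)
                 (fibre-connected a x y (just-injective πx) (just-injective πy))
    ; edges = λ a b ab → let _ , x , y , πx , πy , xy = Adj⇒Linked ab
                         in x , y , cong just πx , cong just πy , xy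
    }

  comap-acyclic : (π-surjective : ∀ a → ∃ λ x → π x ≡ a) (Q : Partition graph) →
                  (∀ {x y} → π x ≡ π y → lab Q (π x) ≡ nothing → x ≡ y) →
                  Acyclic (QAdj graph Q) → Acyclic (QAdj G (comap π π-surjective Q))
  comap-acyclic π-surjective Q π-injective-on-free =
    Embedding.acyclic (comap π π-surjective Q) Q π φ π-edge preserves reflects
    where
    φ : QV G (comap π π-surjective Q) → QV graph Q
    φ (inj₁ (x , free)) = inj₁ (π x , free)
    φ (inj₂ i)          = inj₂ i

    preserves : ∀ {a x} → a ∈[ comap π π-surjective Q ] x → π a ∈[ Q ] φ x
    preserves {x = inj₁ _} refl = refl
    preserves {x = inj₂ _} a∈x  = a∈x

    reflects : ∀ {a x} → π a ∈[ Q ] φ x → a ∈[ comap π π-surjective Q ] x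
    reflects {x = inj₁ (_ , free)} πa≡πx =
      π-injective-on-free πa≡πx (trans (cong (lab Q) πa≡πx) free)
    reflects {x = inj₂ _}          a∈x   = a∈x

module Merge {m : ℕ} {v u : Fin (suc m)} (v≢u : v ≢ u) where

  merge : Fin (suc m) → Fin m
  merge x with v ≟ x
  ... | yes _   = punchOut v≢u
  ... | no v≢x = punchOut v≢x

  merge-punchIn : ∀ a → merge (punchIn v a) ≡ a
  merge-punchIn a with v ≟ punchIn v a
  ... | yes v≡ιa = contradiction (sym v≡ιa) (punchInᵢ≢i v a)
  ... | no _     = trans (punchOut-cong v refl) (punchOut-punchIn v)

  merge-surjective : ∀ a → ∃ λ x → merge x ≡ a
  merge-surjective a = punchIn v a , merge-punchIn a

  merge-fibre : ∀ {x y} → merge x ≡ merge y → x ≡ y ⊎ (x ≡ v × y ≡ u) ⊎ (x ≡ u × y ≡ v)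
  merge-fibre {x} {y} e with v ≟ x | v ≟ y
  ... | yes refl | yes refl = inj₁ refl
  ... | yes refl | no v≢y   = inj₂ (inj₁ (refl , sym (punchOut-injective v≢u v≢y e)))
  ... | no v≢x   | yes refl = inj₂ (inj₂ (punchOut-injective v≢x v≢u e , refl))
  ... | no v≢x   | no v≢y   = inj₁ (punchOut-injective v≢x v≢y e)

  merge-injective-off : ∀ {x y} → merge x ≡ merge y → merge x ≢ merge v → x ≡ y
  merge-injective-off e off with merge-fibre e
  ... | inj₁ x≡y               = x≡y
  ... | inj₂ (inj₁ (refl , _)) = contradiction refl off
  ... | inj₂ (inj₂ (_ , refl)) = contradiction e off

  ∑-∘-merge : (f : Fin m → ℕ) → ∑ (f ∘ merge) ≡ f (merge v) + ∑ f
  ∑-∘-merge f =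
    trans (sum-remove {i = v} (f ∘ merge)) (cong (f (merge v) +_) (sum-cong-≗ (cong f ∘ merge-punchIn)))

contraction-idf : (G : Graph) {u v : Fin (n G)} → Adj G u v →
                  ∃ λ H → ProperMinor H G × (∀ {k} → InF k H → InF (k + 2) G)
contraction-idf record { n = zero } {()}
contraction-idf G@record { n = suc m } {u} {v} uv =
  graph , (minor merge-surjective fibre-connected , <⇒¬Iso (n<1+n m)) , lift
  where
  v≢u : v ≢ u
  v≢u refl = Adj-irrefl G uv

  open Merge v≢u
  open Quotient G merge

  fibre-connected : ∀ a x y → merge x ≡ a → merge y ≡ a → Star (InFibre a) x y
  fibre-connected a x y πx πy with merge-fibre (trans πx (sym πy))
  ... | inj₁ refl               = ε
  ... | inj₂ (inj₁ (refl , refl)) = (Adj-sym G uv , πx , πy) ◅ ε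
  ... | inj₂ (inj₂ (refl , refl)) = (uv , πx , πy) ◅ ε

  lifted : Partition graph → Partition G
  lifted = comap merge merge-surjective

  order-lifted : (Q : Partition graph) → order (lifted Q) ≤ suc (order Q)
  order-lifted Q = begin
    order (lifted Q)                               ≡⟨ order-∑ (lifted Q) ⟩
    ∑ (weight ∘ lab Q ∘ merge)                     ≡⟨ ∑-∘-merge (weight ∘ lab Q) ⟩
    weight (lab Q (merge v)) + ∑ (weight ∘ lab Q)  ≤⟨ +-monoˡ-≤ _ (weight≤1 (lab Q (merge v))) ⟩
    suc (∑ (weight ∘ lab Q))                       ≡⟨ cong suc (order-∑ Q) ⟨
    suc (order Q)                                  ∎
    where open ≤-Reasoning

  lift : ∀ {k} → InF k graph → InF (k + 2) G
  lift {k} (P , order≤k , P-acyclic) with cover P (merge v)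
  ... | Q , (_ , merged∈Q) , order≤ , Q-acyclic =
    lifted Q ,
    subst (order (lifted Q) ≤_) (+-comm 2 k)
          (≤-trans (order-lifted Q) (s≤s (≤-trans order≤ (s≤s order≤k)))) ,
    comap-acyclic merge-surjective Q injective-on-free (Q-acyclic P-acyclic)
    where
    injective-on-free : ∀ {x y} → merge x ≡ merge y → lab Q (merge x) ≡ nothing → x ≡ y
    injective-on-free e free = merge-injective-off e λ merged →
      contradiction (trans (sym merged∈Q) (trans (cong (lab Q) (sym merged)) free)) λ ()

lemma4p7 : (k : ℕ) (G : Graph) → Obstruction (InF k) G → InF (k + 2) G × ¬ InF k G
lemma4p7 k G (G∉F , minors∈F) with edge? G
... | no edgeless = contradiction (edgeless⇒InF k edgeless) G∉F
... | yes (_ , _ , uv) =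
  let H , H<G , lift = contraction-idf G uv
  in lift (minors∈F H H<G) , G∉F
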